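{- Let $n$ be a positive integer, $(i,j)\in\Pi_n$ and $k\ge 0$ an integer. Then \[ \sum_{\ell=0}^{k}\binom{i-1}{\ell}\binom{j-1}{\ell}\binom{n-i}{k-\ell}\binom{n-j}{k-\ell} \] equals the number of facets $F\ni(i,j)$ of $\Delta_n$ such that $\#\big(\mathrm{R}(F)\setminus\{(i,j)\}\big)=k$.
   Context: $\Pi_n=\{(x,y):1\le x,y\le n\}$ with the product order $(x,y)\preceq(x',y')$ iff $x\le x'$ and $y\le y'$; $\Delta_n$ is its order complex (faces are chains), whose facets are the maximal chains from $(1,1)$ to $(n,n)$ (lattice paths of south/east unit steps). For a facet $F$, $\mathrm{R}(F)=\{(x,y)\in F:(x-1,y)\in F\text{ and }(x,y+1)\in F\}$ (the points where a step increasing the first coordinate is followed by a step increasing the second coordinate). Binomial coefficients $\binom{a}{b}$ are $0$ when $b<0$ or $b>a\ge0$. -}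

module Defs where

open import Data.Nat using (ℕ; zero; suc; _+_; _∸_; _≡ᵇ_)
open import Data.Nat.Combinatorics using (_C_)
open import Data.Bool using (Bool; true; false; _∧_; not; if_then_else_)
open import Data.Product using (_×_; _,_)
open import Data.List using (List; []; _∷_; map; upTo; length; filterᵇ; _++_)
open import Data.Bool.ListAction using (any)
open import Data.Nat.ListAction using (sum)

-- Points of Π_n (coordinates are natural numbers; in Π_n they lie in 1..n).
Point : Set
Point = ℕ × ℕ

_≡ᴾ_ : Point → Point → Bool
(a , b) ≡ᴾ (c , d) = (a ≡ᵇ c) ∧ (b ≡ᵇ d)

_∈ᵇ_ : Point → List Point → Bool
p ∈ᵇ F = any (p ≡ᴾ_) F

data Step : Set where
  X Y : Step

move : Step → Point → Point
move X (x , y) = (suc x , y)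
move Y (x , y) = (x , suc y)

points : Point → List Step → List Point
points p []       = p ∷ []
points p (s ∷ ss) = p ∷ points (move s p) ss

words : ℕ → List (List Step)
words zero    = [] ∷ []
words (suc m) = map (X ∷_) (words m) ++ map (Y ∷_) (words m)

countX : List Step → ℕ
countX []       = 0
countX (X ∷ ss) = suc (countX ss)
countX (Y ∷ ss) = countX ss

-- Facets of Δ_n = maximal chains of Π_n from (1,1) to (n,n), i.e. lattice
-- paths with 2(n-1) unit steps, exactly n-1 of which increase the first
-- coordinate.  Each facet is listed once, as its set (list) of points.
facets : ℕ → List (List Point)
facets n = map (points (1 , 1))
               (filterᵇ (λ w → countX w ≡ᵇ (n ∸ 1)) (words ((n ∸ 1) + (n ∸ 1))))

-- R(F) = {(x,y) ∈ F : (x-1,y) ∈ F and (x,y+1) ∈ F}.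
-- (Points of F have x ≥ 1, and (0,y) ∉ F, so truncated subtraction is harmless.)
R : List Point → List Point
R F = filterᵇ (λ { (x , y) → ((x ∸ 1 , y) ∈ᵇ F) ∧ ((x , suc y) ∈ᵇ F) }) F

-- #(R(F) \ {(i,j)})   (points of a path are pairwise distinct)
RminusCount : List Point → Point → ℕ
RminusCount F p = length (filterᵇ (λ q → not (q ≡ᴾ p)) (R F))

facetCount : ℕ → ℕ → ℕ → ℕ → ℕ
facetCount n i j k =
  length (filterᵇ (λ F → ((i , j) ∈ᵇ F) ∧ (RminusCount F (i , j) ≡ᵇ k)) (facets n))

binomSum : ℕ → ℕ → ℕ → ℕ → ℕ
binomSum n i j k =
  sum (map (λ ℓ → ((i ∸ 1) C ℓ) Data.Nat.* ((j ∸ 1) C ℓ)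
                  Data.Nat.* ((n ∸ i) C (k ∸ ℓ)) Data.Nat.* ((n ∸ j) C (k ∸ ℓ)))
           (upTo (suc k)))

{-# OPTIONS --safe #-}
-- A facet is a word in the steps X and Y, and its path meets every level x + y at most once,
-- so it passes through (i,j) exactly when its first i+j-2 steps form a word u with i-1 X's;
-- it then continues with a word v with n-i X's.  The points of R(F) are the corners of the path
-- (an X step followed by a Y step); every corner lies inside u or inside v except possibly the
-- one at (i,j), which is precisely the point removed.  So the count is the convolution
-- over ℓ of the numbers of words with a X's, b Y's and ℓ corners, and that number is
-- C(a,ℓ)·C(b,ℓ) by induction on the first step and Pascal's rule.
module Submission where

open import Defs
open import Data.Nat using (ℕ; zero; suc; _+_; _*_; _∸_; _≤_; _<_; _≡ᵇ_; _<ᵇ_; z≤n; s≤s)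
open import Data.Nat.Properties
open import Data.Nat.Combinatorics using (_C_; nCk+nC[k+1]≡[n+1]C[k+1])
open import Data.Nat.ListAction using (sum)
open import Data.Nat.ListAction.Properties using (sum-++)
open import Algebra.Properties.CommutativeSemigroup +-commutativeSemigroup using (interchange)
open import Data.Bool using (Bool; true; false; _∧_; _∨_; not; if_then_else_; T)
open import Data.Unit using (tt)
open import Data.Bool.Properties using (∧-zeroʳ; ∧-identityʳ; ∨-identityʳ)
open import Data.Product using (_,_; proj₁; proj₂)
open import Data.List using (List; []; _∷_; map; upTo; length; filterᵇ; _++_)
open import Data.List.Properties using (map-++; map-∘; map-cong; map-applyUpTo; map-upTo)
open import Function using (_∘_)
open import Relation.Nullary.Decidable using (dec-true; dec-false; _×-dec_)
open import Relation.Binary.PropositionalEquality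

𝟙 : Bool → ℕ
𝟙 b = if b then 1 else 0

∑ : {A : Set} → List A → (A → ℕ) → ℕ
∑ xs f = sum (map f xs)

count : {A : Set} → (A → Bool) → List A → ℕ
count P xs = ∑ xs (𝟙 ∘ P)

module _ {A : Set} where

  ∑-cong : {f g : A → ℕ} (xs : List A) → (∀ x → f x ≡ g x) → ∑ xs f ≡ ∑ xs g
  ∑-cong xs f≗g = cong sum (map-cong f≗g xs)

  ∑-zero : (xs : List A) → ∑ xs (λ _ → 0) ≡ 0
  ∑-zero []       = refl
  ∑-zero (x ∷ xs) = ∑-zero xs

  ∑-++ : (xs ys : List A) (f : A → ℕ) → ∑ (xs ++ ys) f ≡ ∑ xs f + ∑ ys f
  ∑-++ xs ys f = trans (cong sum (map-++ f xs ys)) (sum-++ (map f xs) (map f ys))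

  ∑-+ : (xs : List A) (f g : A → ℕ) → ∑ xs (λ x → f x + g x) ≡ ∑ xs f + ∑ xs g
  ∑-+ []       f g = refl
  ∑-+ (x ∷ xs) f g = trans (cong (f x + g x +_) (∑-+ xs f g)) (interchange (f x) (g x) _ _)

  ∑-map : {B : Set} (xs : List A) (g : A → B) (f : B → ℕ) → ∑ (map g xs) f ≡ ∑ xs (f ∘ g)
  ∑-map xs g f = cong sum (sym (map-∘ xs))

  length-filterᵇ : (P : A → Bool) (xs : List A) → length (filterᵇ P xs) ≡ count P xs
  length-filterᵇ P []       = refl
  length-filterᵇ P (x ∷ xs) with P x
  ... | true  = cong suc (length-filterᵇ P xs)
  ... | false = length-filterᵇ P xs

  count-filterᵇ : (Q P : A → Bool) (xs : List A) → count Q (filterᵇ P xs) ≡ count (λ x → P x ∧ Q x) xs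
  count-filterᵇ Q P []       = refl
  count-filterᵇ Q P (x ∷ xs) with P x
  ... | true  = cong (𝟙 (Q x) +_) (count-filterᵇ Q P xs)
  ... | false = count-filterᵇ Q P xs

  count-∧-false : (Q : A → Bool) (xs : List A) → count (λ x → Q x ∧ false) xs ≡ 0
  count-∧-false Q xs = trans (∑-cong xs (λ x → cong 𝟙 (∧-zeroʳ (Q x)))) (∑-zero xs)

  count-guarded : (Q R : A → Bool) (b : Bool) (xs : List A) →
                  count (λ x → Q x ∧ (b ∧ R x)) xs ≡ (if b then count (λ x → Q x ∧ R x) xs else 0)
  count-guarded Q R true  xs = refl
  count-guarded Q R false xs = count-∧-false Q xs

∑-upTo-suc : (m : ℕ) (f : ℕ → ℕ) → ∑ (upTo (suc m)) f ≡ f 0 + ∑ (upTo m) (f ∘ suc)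
∑-upTo-suc m f = cong (λ xs → f 0 + sum xs) (trans (map-applyUpTo suc f m) (sym (map-upTo (f ∘ suc) m)))

∑-indicator : (m c : ℕ) (h : ℕ → ℕ) →
              ∑ (upTo m) (λ ℓ → 𝟙 (c ≡ᵇ ℓ) * h ℓ) ≡ (if c <ᵇ m then h c else 0)
∑-indicator zero    c       h = refl
∑-indicator (suc m) zero    h =
  trans (∑-upTo-suc m (λ ℓ → 𝟙 (0 ≡ᵇ ℓ) * h ℓ))
        (trans (cong (h 0 + 0 +_) (∑-zero (upTo m))) (trans (+-identityʳ _) (+-identityʳ _)))
∑-indicator (suc m) (suc c) h =
  trans (∑-upTo-suc m (λ ℓ → 𝟙 (suc c ≡ᵇ ℓ) * h ℓ)) (∑-indicator m c (h ∘ suc))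

+-≡ᵇ-split : (c d k : ℕ) → (c + d ≡ᵇ k) ≡ (c <ᵇ suc k) ∧ (d ≡ᵇ k ∸ c)
+-≡ᵇ-split zero    d k       = refl
+-≡ᵇ-split (suc c) d zero    = refl
+-≡ᵇ-split (suc c) d (suc k) = +-≡ᵇ-split c d k

+-cancelˡ-≡ᵇ : (a m n : ℕ) → (a + m ≡ᵇ a + n) ≡ (m ≡ᵇ n)
+-cancelˡ-≡ᵇ zero    m n = refl
+-cancelˡ-≡ᵇ (suc a) m n = +-cancelˡ-≡ᵇ a m n

module _ {B : Set} (Q : B → Bool) (g : B → ℕ) (k : ℕ) (vs : List B) where

  countWith : ℕ → ℕ
  countWith ℓ = count (λ v → Q v ∧ (g v ≡ᵇ k ∸ ℓ)) vs

  count-shifted : (c : ℕ) →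
    count (λ v → Q v ∧ (c + g v ≡ᵇ k)) vs ≡ ∑ (upTo (suc k)) (λ ℓ → 𝟙 (c ≡ᵇ ℓ) * countWith ℓ)
  count-shifted c = begin
    count (λ v → Q v ∧ (c + g v ≡ᵇ k)) vs
      ≡⟨ ∑-cong vs (λ v → cong (λ b → 𝟙 (Q v ∧ b)) (+-≡ᵇ-split c (g v) k)) ⟩
    count (λ v → Q v ∧ ((c <ᵇ suc k) ∧ (g v ≡ᵇ k ∸ c))) vs
      ≡⟨ count-guarded Q (λ v → g v ≡ᵇ k ∸ c) (c <ᵇ suc k) vs ⟩
    (if c <ᵇ suc k then countWith c else 0)
      ≡⟨ ∑-indicator (suc k) c countWith ⟨
    ∑ (upTo (suc k)) (λ ℓ → 𝟙 (c ≡ᵇ ℓ) * countWith ℓ) ∎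
    where open ≡-Reasoning

  ∑-convolution : {A : Set} (P : A → Bool) (f : A → ℕ) (us : List A) →
    ∑ us (λ u → count (λ v → P u ∧ (Q v ∧ (f u + g v ≡ᵇ k))) vs) ≡
    ∑ (upTo (suc k)) (λ ℓ → count (λ u → P u ∧ (f u ≡ᵇ ℓ)) us * countWith ℓ)
  ∑-convolution P f []       = sym (∑-zero (upTo (suc k)))
  ∑-convolution P f (u ∷ us) = begin
    count (λ v → P u ∧ (Q v ∧ (f u + g v ≡ᵇ k))) vs + ∑ us _
      ≡⟨ cong₂ _+_ (single (P u)) (∑-convolution P f us) ⟩
    ∑ (upTo (suc k)) (λ ℓ → 𝟙 (P u ∧ (f u ≡ᵇ ℓ)) * countWith ℓ) + ∑ (upTo (suc k)) _
      ≡⟨ ∑-+ (upTo (suc k)) (λ ℓ → 𝟙 (P u ∧ (f u ≡ᵇ ℓ)) * countWith ℓ)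
                             (λ ℓ → count (λ u → P u ∧ (f u ≡ᵇ ℓ)) us * countWith ℓ) ⟨
    ∑ (upTo (suc k)) (λ ℓ → 𝟙 (P u ∧ (f u ≡ᵇ ℓ)) * countWith ℓ
                            + count (λ u → P u ∧ (f u ≡ᵇ ℓ)) us * countWith ℓ)
      ≡⟨ ∑-cong (upTo (suc k)) (λ ℓ → *-distribʳ-+ (countWith ℓ) (𝟙 (P u ∧ (f u ≡ᵇ ℓ))) _) ⟨
    ∑ (upTo (suc k)) (λ ℓ → count (λ u → P u ∧ (f u ≡ᵇ ℓ)) (u ∷ us) * countWith ℓ) ∎
    where
    open ≡-Reasoning
    single : (b : Bool) → count (λ v → b ∧ (Q v ∧ (f u + g v ≡ᵇ k))) vs ≡
                          ∑ (upTo (suc k)) (λ ℓ → 𝟙 (b ∧ (f u ≡ᵇ ℓ)) * countWith ℓ)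
    single true  = count-shifted (f u)
    single false = trans (∑-zero vs) (sym (∑-zero (upTo (suc k))))

∑-words-suc : (m : ℕ) (f : List Step → ℕ) →
              ∑ (words (suc m)) f ≡ ∑ (words m) (f ∘ (X ∷_)) + ∑ (words m) (f ∘ (Y ∷_))
∑-words-suc m f = trans (∑-++ (map (X ∷_) (words m)) (map (Y ∷_) (words m)) f)
                        (cong₂ _+_ (∑-map (words m) (X ∷_) f) (∑-map (words m) (Y ∷_) f))

∑-words-cong : (m : ℕ) {f g : List Step → ℕ} → (∀ w → length w ≡ m → f w ≡ g w) →
               ∑ (words m) f ≡ ∑ (words m) g
∑-words-cong zero    f≗g = cong (_+ 0) (f≗g [] refl)
∑-words-cong (suc m) {f} {g} f≗g = begin
  ∑ (words (suc m)) f
    ≡⟨ ∑-words-suc m f ⟩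
  ∑ (words m) (f ∘ (X ∷_)) + ∑ (words m) (f ∘ (Y ∷_))
    ≡⟨ cong₂ _+_ (∑-words-cong m (λ w → f≗g (X ∷ w) ∘ cong suc))
                 (∑-words-cong m (λ w → f≗g (Y ∷ w) ∘ cong suc)) ⟩
  ∑ (words m) (g ∘ (X ∷_)) + ∑ (words m) (g ∘ (Y ∷_))
    ≡⟨ ∑-words-suc m g ⟨
  ∑ (words (suc m)) g   ∎
  where open ≡-Reasoning

∑-words-+ : (a b : ℕ) (f : List Step → ℕ) →
            ∑ (words (a + b)) f ≡ ∑ (words a) (λ u → ∑ (words b) (λ v → f (u ++ v)))
∑-words-+ zero    b f = sym (+-identityʳ _)
∑-words-+ (suc a) b f = trans (∑-words-suc (a + b) f)
  (trans (cong₂ _+_ (∑-words-+ a b (f ∘ (X ∷_))) (∑-words-+ a b (f ∘ (Y ∷_))))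
         (sym (∑-words-suc a (λ u → ∑ (words b) (λ v → f (u ++ v))))))

countX≤length : (w : List Step) → countX w ≤ length w
countX≤length []      = z≤n
countX≤length (X ∷ w) = s≤s (countX≤length w)
countX≤length (Y ∷ w) = m≤n⇒m≤1+n (countX≤length w)

count-words-countX> : (m a : ℕ) (Q : List Step → Bool) → m < a →
                      count (λ w → (countX w ≡ᵇ a) ∧ Q w) (words m) ≡ 0
count-words-countX> m a Q m<a = trans (∑-words-cong m too-many) (∑-zero (words m))
  where
  too-many : ∀ w → length w ≡ m → 𝟙 ((countX w ≡ᵇ a) ∧ Q w) ≡ 0
  too-many w refl = cong (λ b → 𝟙 (b ∧ Q w))
                         (dec-false (countX w ≟ a) (<⇒≢ (≤-<-trans (countX≤length w) m<a)))

corners : Bool → List Step → ℕ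
corners afterX []      = 0
corners afterX (X ∷ w) = corners true w
corners afterX (Y ∷ w) = 𝟙 afterX + corners false w

cornerCount : Bool → ℕ → ℕ → ℕ → ℕ
cornerCount afterX a c m = count (λ w → (countX w ≡ᵇ a) ∧ (corners afterX w ≡ᵇ c)) (words m)

-- Prefixing the preceding X step, these are the words with a+1 X's starting with X:
-- for b ≥ 1 there are C(a+1,c)·C(b-1,c-1) of them.
cornerCountAfterX : ℕ → ℕ → ℕ → ℕ
cornerCountAfterX a zero    zero    = 1
cornerCountAfterX a zero    (suc c) = 0
cornerCountAfterX a (suc b) zero    = 0
cornerCountAfterX a (suc b) (suc c) = (suc a C suc c) * (b C c)

cornerCount-fresh   : (a b c : ℕ) → cornerCount false a c (a + b) ≡ (a C c) * (b C c)
cornerCount-afterX  : (a b c : ℕ) → cornerCount true a c (a + b) ≡ cornerCountAfterX a b c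

cornerCount-fresh zero zero zero    = refl
cornerCount-fresh zero zero (suc c) = refl
cornerCount-fresh zero (suc b) c =
  trans (∑-words-suc b _) (trans (cong₂ _+_ (∑-zero (words b)) (cornerCount-fresh zero b c)) (recurrence c))
  where
  recurrence : ∀ c → (0 C c) * (b C c) ≡ (0 C c) * (suc b C c)
  recurrence zero    = refl
  recurrence (suc c) = refl
cornerCount-fresh (suc a) zero c =
  trans (∑-words-suc (a + 0) _)
        (trans (cong₂ _+_ (cornerCount-afterX a zero c)
                          (count-words-countX> (a + 0) (suc a) _ (s≤s (≤-reflexive (+-identityʳ a)))))
               (recurrence c))
  where
  recurrence : ∀ c → cornerCountAfterX a 0 c + 0 ≡ (suc a C c) * (0 C c)
  recurrence zero    = refl
  recurrence (suc c) = sym (*-zeroʳ (suc a C suc c))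
cornerCount-fresh (suc a) (suc b) c =
  trans (∑-words-suc (a + suc b) _)
        (trans (cong₂ _+_ (cornerCount-afterX a (suc b) c)
                          (trans (cong (cornerCount false (suc a) c) (+-suc a b)) (cornerCount-fresh (suc a) b c)))
               (recurrence c))
  where
  recurrence : ∀ c → cornerCountAfterX a (suc b) c + (suc a C c) * (b C c) ≡ (suc a C c) * (suc b C c)
  recurrence zero    = refl
  recurrence (suc c) = trans (sym (*-distribˡ-+ (suc a C suc c) (b C c) (b C suc c)))
                        (cong ((suc a C suc c) *_) (nCk+nC[k+1]≡[n+1]C[k+1] b c))

cornerCount-afterX zero zero zero    = refl
cornerCount-afterX zero zero (suc c) = refl
cornerCount-afterX zero (suc b) zero =
  trans (∑-words-suc b _) (cong₂ _+_ (∑-zero (words b)) (count-∧-false _ (words b)))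
cornerCount-afterX zero (suc b) (suc c) =
  trans (∑-words-suc b _) (trans (cong₂ _+_ (∑-zero (words b)) (cornerCount-fresh zero b c)) (recurrence c))
  where
  recurrence : ∀ c → (0 C c) * (b C c) ≡ (1 C suc c) * (b C c)
  recurrence zero    = refl
  recurrence (suc c) = refl
cornerCount-afterX (suc a) zero c =
  trans (∑-words-suc (a + 0) _)
        (trans (cong₂ _+_ (cornerCount-afterX a zero c)
                          (count-words-countX> (a + 0) (suc a) _ (s≤s (≤-reflexive (+-identityʳ a)))))
               (recurrence c))
  where
  recurrence : ∀ c → cornerCountAfterX a 0 c + 0 ≡ cornerCountAfterX (suc a) 0 c
  recurrence zero    = refl
  recurrence (suc c) = refl
cornerCount-afterX (suc a) (suc b) zero =
  trans (∑-words-suc (a + suc b) _) (cong₂ _+_ (cornerCount-afterX a (suc b) zero) (count-∧-false _ (words (a + suc b))))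
cornerCount-afterX (suc a) (suc b) (suc c) =
  trans (∑-words-suc (a + suc b) _)
        (trans (cong₂ _+_ (cornerCount-afterX a (suc b) (suc c))
                          (trans (cong (cornerCount false (suc a) c) (+-suc a b)) (cornerCount-fresh (suc a) b c)))
               (trans (sym (*-distribʳ-+ (b C c) (suc a C suc c) (suc a C c)))
                      (cong (_* (b C c)) (trans (+-comm (suc a C suc c) (suc a C c)) (nCk+nC[k+1]≡[n+1]C[k+1] (suc a) c)))))

level : Point → ℕ
level (x , y) = x + y

level-move : (s : Step) (p : Point) → level (move s p) ≡ suc (level p)
level-move X (x , y) = refl
level-move Y (x , y) = +-suc x y

level-<-move : (s : Step) (p : Point) → level p < level (move s p)
level-<-move s p = ≤-reflexive (sym (level-move s p))

level-move-+ : (s : Step) (p : Point) (n : ℕ) → level (move s p) + n ≡ level p + suc n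
level-move-+ s p n = trans (cong (_+ n) (level-move s p)) (sym (+-suc (level p) n))

≡ᴾ-refl : (p : Point) → (p ≡ᴾ p) ≡ true
≡ᴾ-refl (x , y) = dec-true ((x ≟ x) ×-dec (y ≟ y)) (refl , refl)

≡ᴾ-≢ : {p q : Point} → p ≢ q → (p ≡ᴾ q) ≡ false
≡ᴾ-≢ {x , y} {x′ , y′} p≢q =
  dec-false ((x ≟ x′) ×-dec (y ≟ y′)) (λ (x≡x′ , y≡y′) → p≢q (cong₂ _,_ x≡x′ y≡y′))

point-≡ : {p q : Point} → proj₁ p ≡ proj₁ q → level p ≡ level q → p ≡ q
point-≡ {x , y} {.x , y′} refl x+y≡x+y′ = cong (x ,_) (+-cancelˡ-≡ x y y′ x+y≡x+y′)

∈ᵇ-points-head : (p : Point) (w : List Step) → (p ∈ᵇ points p w) ≡ true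
∈ᵇ-points-head p []      = cong (_∨ false) (≡ᴾ-refl p)
∈ᵇ-points-head p (s ∷ w) = cong (_∨ (p ∈ᵇ points (move s p) w)) (≡ᴾ-refl p)

∈ᵇ-points-∷ : (q p : Point) (s : Step) (w : List Step) → q ≢ p →
              (q ∈ᵇ points p (s ∷ w)) ≡ (q ∈ᵇ points (move s p) w)
∈ᵇ-points-∷ q p s w q≢p = cong (_∨ (q ∈ᵇ points (move s p) w)) (≡ᴾ-≢ q≢p)

∉-points-monotone : (f : Point → ℕ) → (∀ s p → f p ≤ f (move s p)) →
                    (q p : Point) (w : List Step) → f q < f p → (q ∈ᵇ points p w) ≡ false
∉-points-monotone f mono q p []      fq<fp = cong (_∨ false) (≡ᴾ-≢ (λ q≡p → <-irrefl (cong f q≡p) fq<fp))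
∉-points-monotone f mono q p (s ∷ w) fq<fp =
  trans (∈ᵇ-points-∷ q p s w (λ q≡p → <-irrefl (cong f q≡p) fq<fp))
        (∉-points-monotone f mono q (move s p) w (<-≤-trans fq<fp (mono s p)))

∉-points-left : (q p : Point) (w : List Step) → proj₁ q < proj₁ p → (q ∈ᵇ points p w) ≡ false
∉-points-left = ∉-points-monotone proj₁ (λ { X (x , y) → n≤1+n x ; Y (x , y) → ≤-refl })

∉-points-below : (q p : Point) (w : List Step) → level q < level p → (q ∈ᵇ points p w) ≡ false
∉-points-below = ∉-points-monotone level (λ s p → <⇒≤ (level-<-move s p))

end : Point → List Step → Point
end p []      = p
end p (s ∷ u) = end (move s p) u

level-end : (p : Point) (u : List Step) → level (end p u) ≡ level p + length u
level-end p []      = sym (+-identityʳ (level p))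
level-end p (s ∷ u) = trans (level-end (move s p) u) (level-move-+ s p (length u))

proj₁-end : (p : Point) (u : List Step) → proj₁ (end p u) ≡ proj₁ p + countX u
proj₁-end p       []      = sym (+-identityʳ (proj₁ p))
proj₁-end (x , y) (X ∷ u) = trans (proj₁-end (suc x , y) u) (sym (+-suc x (countX u)))
proj₁-end (x , y) (Y ∷ u) = proj₁-end (x , suc y) u

∈ᵇ-points-++ : (q p : Point) (u v : List Step) → level q ≡ level p + length u →
               (q ∈ᵇ points p (u ++ v)) ≡ (q ≡ᴾ end p u)
∈ᵇ-points-++ q p [] []      _ = ∨-identityʳ (q ≡ᴾ p)
∈ᵇ-points-++ q p [] (s ∷ v) q-level =
  trans (cong ((q ≡ᴾ p) ∨_) (∉-points-below q (move s p) v q-below))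
        (∨-identityʳ (q ≡ᴾ p))
  where
  q-below : level q < level (move s p)
  q-below = subst (_< level (move s p)) (sym (trans q-level (+-identityʳ (level p)))) (level-<-move s p)
∈ᵇ-points-++ q p (s ∷ u) v q-level =
  trans (∈ᵇ-points-∷ q p s (u ++ v) (λ q≡p → m+1+n≢m (level p) (trans (sym q-level) (cong level q≡p))))
        (∈ᵇ-points-++ q (move s p) u v (trans q-level (sym (level-move-+ s p (length u)))))

lastIsX : Bool → List Step → Bool
lastIsX afterX []      = afterX
lastIsX afterX (X ∷ u) = lastIsX true u
lastIsX afterX (Y ∷ u) = lastIsX false u

cornersAvoiding : Point → Bool → Point → List Step → ℕ
cornersAvoiding q afterX p []      = 0
cornersAvoiding q afterX p (X ∷ w) = cornersAvoiding q true (move X p) w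
cornersAvoiding q afterX p (Y ∷ w) = 𝟙 (afterX ∧ not (p ≡ᴾ q)) + cornersAvoiding q false (move Y p) w

𝟙-avoiding : (b : Bool) (p q : Point) → p ≢ q → 𝟙 (b ∧ not (p ≡ᴾ q)) ≡ 𝟙 b
𝟙-avoiding b p q p≢q = trans (cong (λ c → 𝟙 (b ∧ not c)) (≡ᴾ-≢ p≢q)) (cong 𝟙 (∧-identityʳ b))

cornersAvoiding-++ : (q : Point) (b : Bool) (p : Point) (u v : List Step) →
  cornersAvoiding q b p (u ++ v) ≡ cornersAvoiding q b p u + cornersAvoiding q (lastIsX b u) (end p u) v
cornersAvoiding-++ q b p []      v = refl
cornersAvoiding-++ q b p (X ∷ u) v = cornersAvoiding-++ q true (move X p) u v
cornersAvoiding-++ q b p (Y ∷ u) v =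
  trans (cong (𝟙 (b ∧ not (p ≡ᴾ q)) +_) (cornersAvoiding-++ q false (move Y p) u v))
        (sym (+-assoc (𝟙 (b ∧ not (p ≡ᴾ q))) _ _))

cornersAvoiding-below : (q : Point) (b : Bool) (p : Point) (u : List Step) →
  level p + length u ≤ level q → cornersAvoiding q b p u ≡ corners b u
cornersAvoiding-below q b p []      _     = refl
cornersAvoiding-below q b p (X ∷ u) below =
  cornersAvoiding-below q true (move X p) u (subst (_≤ level q) (sym (level-move-+ X p (length u))) below)
cornersAvoiding-below q b p (Y ∷ u) below =
  cong₂ _+_ (𝟙-avoiding b p q (λ p≡q → <-irrefl (cong level p≡q) (<-≤-trans (m<m+n (level p) (s≤s z≤n)) below)))
            (cornersAvoiding-below q false (move Y p) u (subst (_≤ level q) (sym (level-move-+ Y p (length u))) below))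

cornersAvoiding-above : (q : Point) (b : Bool) (p : Point) (u : List Step) →
  level q < level p → cornersAvoiding q b p u ≡ corners b u
cornersAvoiding-above q b p []      _     = refl
cornersAvoiding-above q b p (X ∷ u) above = cornersAvoiding-above q true (move X p) u (<-trans above (level-<-move X p))
cornersAvoiding-above q b p (Y ∷ u) above =
  cong₂ _+_ (𝟙-avoiding b p q (λ p≡q → <-irrefl (cong level (sym p≡q)) above))
            (cornersAvoiding-above q false (move Y p) u (<-trans above (level-<-move Y p)))

cornersAvoiding-from : (q : Point) (b : Bool) (v : List Step) → cornersAvoiding q b q v ≡ corners false v
cornersAvoiding-from q b []      = refl
cornersAvoiding-from q b (X ∷ v) = cornersAvoiding-above q true (move X q) v (level-<-move X q)
cornersAvoiding-from q b (Y ∷ v) =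
  cong₂ _+_ (trans (cong (λ c → 𝟙 (b ∧ not c)) (≡ᴾ-refl q)) (cong 𝟙 (∧-zeroʳ b)))
            (cornersAvoiding-above q false (move Y q) v (level-<-move Y q))

cornersAvoiding-through : (p q : Point) (u v : List Step) → end p u ≡ q →
  cornersAvoiding q false p (u ++ v) ≡ corners false u + corners false v
cornersAvoiding-through p q u v end≡q = trans (cornersAvoiding-++ q false p u v)
  (cong₂ _+_ (cornersAvoiding-below q false p u (≤-reflexive (trans (sym (level-end p u)) (cong level end≡q))))
             (trans (cong (λ r → cornersAvoiding q (lastIsX false u) r v) end≡q)
                    (cornersAvoiding-from q (lastIsX false u) v)))

isR : List Point → Point → Bool
isR F (x , y) = ((x ∸ 1 , y) ∈ᵇ F) ∧ ((x , suc y) ∈ᵇ F)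

RminusCount-isR : (F : List Point) (q : Point) → RminusCount F q ≡ count (λ p → isR F p ∧ not (p ≡ᴾ q)) F
RminusCount-isR F q =
  trans (length-filterᵇ _ (R F)) (trans (count-filterᵇ _ _ F) (∑-cong F (λ { (x , y) → refl })))

startsWithY : List Step → Bool
startsWithY (Y ∷ _) = true
startsWithY _       = false

move-Y-∈ᵇ-points : (p : Point) (w : List Step) → (move Y p ∈ᵇ points p w) ≡ startsWithY w
move-Y-∈ᵇ-points (x , y) []      = cong (_∨ false) (≡ᴾ-≢ {x , suc y} {x , y} (1+n≢n ∘ cong proj₂))
move-Y-∈ᵇ-points (x , y) (X ∷ w) =
  trans (∈ᵇ-points-∷ (x , suc y) (x , y) X w (1+n≢n ∘ cong proj₂))
        (∉-points-left (x , suc y) (suc x , y) w (n<1+n x))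
move-Y-∈ᵇ-points (x , y) (Y ∷ w) =
  trans (∈ᵇ-points-∷ (x , suc y) (x , y) Y w (1+n≢n ∘ cong proj₂)) (∈ᵇ-points-head (x , suc y) w)

-- The invariant along which R(F) is read off the path F one step at a time.
Agrees : List Point → Point → List Step → Set
Agrees F p w = ∀ q → level p ≤ level q → (q ∈ᵇ F) ≡ (q ∈ᵇ points p w)

agrees-move : {F : List Point} {p : Point} (s : Step) (w : List Step) → Agrees F p (s ∷ w) → Agrees F (move s p) w
agrees-move {F} {p} s w agrees q above =
  trans (agrees q (<⇒≤ p<q)) (∈ᵇ-points-∷ q p s w (λ q≡p → <-irrefl (cong level (sym q≡p)) p<q))
  where
  p<q : level p < level q
  p<q = <-≤-trans (level-<-move s p) above

isR-agrees : {F : List Point} (x y : ℕ) (w : List Step) → Agrees F (suc x , y) w →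
             isR F (suc x , y) ≡ ((x , y) ∈ᵇ F) ∧ startsWithY w
isR-agrees {F} x y w agrees = cong (((x , y) ∈ᵇ F) ∧_)
  (trans (agrees (suc x , suc y) (+-monoʳ-≤ (suc x) (n≤1+n y))) (move-Y-∈ᵇ-points (suc x , y) w))

module _ (F : List Point) (q : Point) where

  count-isR-avoiding : (b : Bool) (x y : ℕ) (w : List Step) → ((x , y) ∈ᵇ F) ≡ b → Agrees F (suc x , y) w →
    count (λ p → isR F p ∧ not (p ≡ᴾ q)) (points (suc x , y) w) ≡ cornersAvoiding q b (suc x , y) w
  count-isR-avoiding b x y [] left∈ agrees =
    cong (λ c → 𝟙 (c ∧ not ((suc x , y) ≡ᴾ q)) + 0)
         (trans (isR-agrees {F} x y [] agrees) (trans (cong (_∧ false) left∈) (∧-zeroʳ b)))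
  count-isR-avoiding b x y (X ∷ w) left∈ agrees =
    cong₂ _+_ (cong (λ c → 𝟙 (c ∧ not ((suc x , y) ≡ᴾ q)))
                    (trans (isR-agrees {F} x y (X ∷ w) agrees) (trans (cong (_∧ false) left∈) (∧-zeroʳ b))))
              (count-isR-avoiding true (suc x) y w here∈ (agrees-move {F} X w agrees))
    where
    here∈ : ((suc x , y) ∈ᵇ F) ≡ true
    here∈ = trans (agrees (suc x , y) ≤-refl) (∈ᵇ-points-head (suc x , y) (X ∷ w))
  count-isR-avoiding b x y (Y ∷ w) left∈ agrees =
    cong₂ _+_ (cong (λ c → 𝟙 (c ∧ not ((suc x , y) ≡ᴾ q)))
                    (trans (isR-agrees {F} x y (Y ∷ w) agrees) (trans (cong (_∧ true) left∈) (∧-identityʳ b))))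
              (count-isR-avoiding false x (suc y) w left∉ (agrees-move {F} Y w agrees))
    where
    left∉ : ((x , suc y) ∈ᵇ F) ≡ false
    left∉ = trans (agrees (x , suc y) (≤-reflexive (sym (+-suc x y))))
                  (trans (∈ᵇ-points-∷ (x , suc y) (suc x , y) Y w (λ x≡1+x → 1+n≢n (sym (cong proj₁ x≡1+x))))
                         (∉-points-left (x , suc y) (suc x , suc y) w (n<1+n x)))

RminusCount-points : (w : List Step) (q : Point) → RminusCount (points (1 , 1) w) q ≡ cornersAvoiding q false (1 , 1) w
RminusCount-points w q = trans (RminusCount-isR (points (1 , 1) w) q)
  (count-isR-avoiding (points (1 , 1) w) q false 0 1 w (∉-points-left (0 , 1) (1 , 1) w (s≤s z≤n)) (λ _ _ → refl))

facetCondition : ℕ → Point → ℕ → List Step → Bool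
facetCondition m q k w = (countX w ≡ᵇ m) ∧ ((q ∈ᵇ points (1 , 1) w) ∧ (RminusCount (points (1 , 1) w) q ≡ᵇ k))

facetCount-words : (n′ i′ j′ k : ℕ) →
  facetCount (suc n′) (suc i′) (suc j′) k ≡ count (facetCondition n′ (suc i′ , suc j′) k) (words (n′ + n′))
facetCount-words n′ i′ j′ k = begin
  length (filterᵇ isFacet (map (points (1 , 1)) (filterᵇ full (words (n′ + n′)))))
    ≡⟨ length-filterᵇ isFacet (map (points (1 , 1)) (filterᵇ full (words (n′ + n′)))) ⟩
  count isFacet (map (points (1 , 1)) (filterᵇ full (words (n′ + n′))))
    ≡⟨ ∑-map (filterᵇ full (words (n′ + n′))) (points (1 , 1)) (𝟙 ∘ isFacet) ⟩
  count (isFacet ∘ points (1 , 1)) (filterᵇ full (words (n′ + n′)))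
    ≡⟨ count-filterᵇ (isFacet ∘ points (1 , 1)) full (words (n′ + n′)) ⟩
  count (facetCondition n′ (suc i′ , suc j′) k) (words (n′ + n′)) ∎
  where
  open ≡-Reasoning
  full : List Step → Bool
  full w = countX w ≡ᵇ n′
  isFacet : List Point → Bool
  isFacet F = ((suc i′ , suc j′) ∈ᵇ F) ∧ (RminusCount F (suc i′ , suc j′) ≡ᵇ k)

countX-++ : (u v : List Step) → countX (u ++ v) ≡ countX u + countX v
countX-++ []      v = refl
countX-++ (X ∷ u) v = cong suc (countX-++ u v)
countX-++ (Y ∷ u) v = countX-++ u v

level-reached : (i′ j′ : ℕ) (u : List Step) → length u ≡ i′ + j′ →
                level (suc i′ , suc j′) ≡ level (1 , 1) + length u
level-reached i′ j′ u |u|≡i′+j′ = cong suc (trans (+-suc i′ j′) (cong suc (sym |u|≡i′+j′)))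

facetCondition-++ : (n′ i′ j′ k : ℕ) → i′ ≤ n′ → (u v : List Step) → length u ≡ i′ + j′ →
  facetCondition n′ (suc i′ , suc j′) k (u ++ v) ≡
  (countX u ≡ᵇ i′) ∧ ((countX v ≡ᵇ n′ ∸ i′) ∧ (corners false u + corners false v ≡ᵇ k))
facetCondition-++ n′ i′ j′ k i′≤n′ u v |u|≡i′+j′ with countX u ≡ᵇ i′ in reached
... | true =
  cong₂ _∧_ remaining-X
            (trans (cong (_∧ (RminusCount (points (1 , 1) (u ++ v)) q ≡ᵇ k)) q∈) (cong (_≡ᵇ k) R-count))
  where
  q : Point
  q = (suc i′ , suc j′)
  countX-u≡i′ : countX u ≡ i′
  countX-u≡i′ = ≡ᵇ⇒≡ (countX u) i′ (subst T (sym reached) tt)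
  end≡q : end (1 , 1) u ≡ q
  end≡q = point-≡ (trans (proj₁-end (1 , 1) u) (cong suc countX-u≡i′))
                  (trans (level-end (1 , 1) u) (sym (level-reached i′ j′ u |u|≡i′+j′)))
  q∈ : (q ∈ᵇ points (1 , 1) (u ++ v)) ≡ true
  q∈ = trans (∈ᵇ-points-++ q (1 , 1) u v (level-reached i′ j′ u |u|≡i′+j′))
             (trans (cong (q ≡ᴾ_) end≡q) (≡ᴾ-refl q))
  R-count : RminusCount (points (1 , 1) (u ++ v)) q ≡ corners false u + corners false v
  R-count = trans (RminusCount-points (u ++ v) q) (cornersAvoiding-through (1 , 1) q u v end≡q)
  remaining-X : (countX (u ++ v) ≡ᵇ n′) ≡ (countX v ≡ᵇ n′ ∸ i′)
  remaining-X = trans (cong₂ _≡ᵇ_ (trans (countX-++ u v) (cong (_+ countX v) countX-u≡i′))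
                                  (sym (m+[n∸m]≡n i′≤n′)))
                      (+-cancelˡ-≡ᵇ i′ (countX v) (n′ ∸ i′))
... | false =
  trans (cong (λ c → (countX (u ++ v) ≡ᵇ n′) ∧ (c ∧ (RminusCount (points (1 , 1) (u ++ v)) q ≡ᵇ k))) q∉)
        (∧-zeroʳ (countX (u ++ v) ≡ᵇ n′))
  where
  q : Point
  q = (suc i′ , suc j′)
  q∉ : (q ∈ᵇ points (1 , 1) (u ++ v)) ≡ false
  q∉ = trans (∈ᵇ-points-++ q (1 , 1) u v (level-reached i′ j′ u |u|≡i′+j′)) (≡ᴾ-≢ {q} {end (1 , 1) u} q≢end)
    where
    q≢end : q ≢ end (1 , 1) u
    q≢end q≡end =
      subst T reached (≡⇒≡ᵇ (countX u) i′ (sym (suc-injective (trans (cong proj₁ q≡end) (proj₁-end (1 , 1) u)))))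

lemma5p3 : (n i j k : ℕ) → 1 ≤ n → 1 ≤ i → i ≤ n → 1 ≤ j → j ≤ n →
           binomSum n i j k ≡ facetCount n i j k
lemma5p3 (suc n′) (suc i′) (suc j′) k _ _ (s≤s i′≤n′) _ (s≤s j′≤n′) = sym (begin
  facetCount (suc n′) (suc i′) (suc j′) k                 ≡⟨ facetCount-words n′ i′ j′ k ⟩
  count φ (words (n′ + n′))                               ≡⟨ cong (count φ ∘ words) n′+n′≡a+b ⟩
  count φ (words (a + b))                                 ≡⟨ ∑-words-+ a b (𝟙 ∘ φ) ⟩
  ∑ (words a) (λ u → count (λ v → φ (u ++ v)) (words b))
    ≡⟨ ∑-words-cong a (λ u |u|≡a →
         ∑-cong (words b) (λ v → cong 𝟙 (facetCondition-++ n′ i′ j′ k i′≤n′ u v |u|≡a))) ⟩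
  ∑ (words a) (λ u → count (λ v → (countX u ≡ᵇ i′) ∧ ((countX v ≡ᵇ n′ ∸ i′) ∧
                                   (corners false u + corners false v ≡ᵇ k))) (words b))
    ≡⟨ ∑-convolution (λ v → countX v ≡ᵇ n′ ∸ i′) (corners false) k (words b)
                     (λ u → countX u ≡ᵇ i′) (corners false) (words a) ⟩
  ∑ (upTo (suc k)) (λ ℓ → cornerCount false i′ ℓ a * cornerCount false (n′ ∸ i′) (k ∸ ℓ) b)
    ≡⟨ ∑-cong (upTo (suc k)) binomials ⟩
  binomSum (suc n′) (suc i′) (suc j′) k                   ∎)
  where
  open ≡-Reasoning
  φ : List Step → Bool
  φ = facetCondition n′ (suc i′ , suc j′) k
  a b : ℕ
  a = i′ + j′
  b = (n′ ∸ i′) + (n′ ∸ j′)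
  n′+n′≡a+b : n′ + n′ ≡ a + b
  n′+n′≡a+b = trans (cong₂ _+_ (sym (m+[n∸m]≡n i′≤n′)) (sym (m+[n∸m]≡n j′≤n′)))
                    (interchange i′ (n′ ∸ i′) j′ (n′ ∸ j′))
  binomials : ∀ ℓ → cornerCount false i′ ℓ a * cornerCount false (n′ ∸ i′) (k ∸ ℓ) b ≡
                    (i′ C ℓ) * (j′ C ℓ) * ((n′ ∸ i′) C (k ∸ ℓ)) * ((n′ ∸ j′) C (k ∸ ℓ))
  binomials ℓ =
    trans (cong₂ _*_ (cornerCount-fresh i′ j′ ℓ) (cornerCount-fresh (n′ ∸ i′) (n′ ∸ j′) (k ∸ ℓ)))
          (sym (*-assoc ((i′ C ℓ) * (j′ C ℓ)) ((n′ ∸ i′) C (k ∸ ℓ)) ((n′ ∸ j′) C (k ∸ ℓ))))
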